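{- Let $n\ge 1$, $c=(c_1,\ldots,c_n)\in\mathsf{DComp}_n$, and let $i\ne k$ be indices in $[n]$ with $c_i,c_k\in\mathsf{Dnu}(c)\cup\mathsf{Do}(c)$. Let $\mathsf{ap}(c_i)=c_j$ and $\mathsf{ap}(c_k)=c_\ell$. Writing $\langle x,y\rangle=\{z\in\mathbb{Z}: \min(x,y)\le z\le\max(x,y)\}$, we have either $\langle i,j\rangle\subseteq\langle k,\ell\rangle$, or $\langle i,j\rangle\supseteq\langle k,\ell\rangle$, or $\langle i,j\rangle\cap\langle k,\ell\rangle=\varnothing$.
   Context: For a sequence $c=(c_1,\ldots,c_l)$ of positive integers and $i\le j$, $f(c;i,j)=\sum_{t=i}^{j}(c_t-2)$. A composition $c$ is dominating if $f(c;1,i)>0$ for all $i$. $\mathsf{DComp}_n$ is the set of dominating compositions of $2n+1$ into exactly $n$ parts. For $c\in\mathsf{DComp}_n$ set $c_{n+1}:=1$; $c_i$ lies in $\mathsf{Dnu}(c)$ if $c_i>1$ and $c_{i+1}>1$, and in $\mathsf{Do}(c)$ if $c_i=1$ and $c_{i+1}=1$. Anchor point: if $c_i\in\mathsf{Dnu}(c)$, $\mathsf{ap}(c_i)=c_j$ with $j$ the smallest index $j>i$ such that $f(c;i+1,j)=0$ and $c_{j+1}=1$; if $c_i\in\mathsf{Do}(c)$, $\mathsf{ap}(c_i)=c_j$ with $j$ the largest index $j<i$ such that $f(c;j,i-1)>0$. -}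

module Defs where

open import Data.Nat using (ℕ; zero; suc; _+_; _*_; _∸_; _≤_; _<_; _⊔_; _⊓_)
open import Data.Integer as ℤ using (ℤ; +_; _-_)
open import Data.List using (List; []; _∷_; length; map; upTo)
open import Data.Nat.ListAction using (sum)
open import Data.List.Relation.Unary.All using (All)
open import Data.Product using (_×_; Σ)
open import Data.Sum using (_⊎_)
open import Relation.Nullary using (¬_)
open import Relation.Binary.PropositionalEquality using (_≡_)

-- 1-based indexing into a sequence; out-of-range positions (in particular
-- position n+1 of a length-n list) read as 1, implementing c_{n+1} := 1.
at : List ℕ → ℕ → ℕ
at []       _             = 1
at (x ∷ xs) zero          = 1
at (x ∷ xs) (suc zero)    = x
at (x ∷ xs) (suc (suc k)) = at xs (suc k)

-- the integers i, i+1, ..., j (empty if j < i)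
range : ℕ → ℕ → List ℕ
range i j = map (λ t → i + t) (upTo (suc j ∸ i))

sumℤ : List ℤ → ℤ
sumℤ []       = + 0
sumℤ (x ∷ xs) = x ℤ.+ sumℤ xs

f : List ℕ → ℕ → ℕ → ℤ
f c i j = sumℤ (map (λ t → + at c t - + 2) (range i j))

Dominating : List ℕ → Set
Dominating c = ∀ i → 1 ≤ i → i ≤ length c → + 0 ℤ.< f c 1 i

DComp : ℕ → List ℕ → Set
DComp n c = All (1 ≤_) c × length c ≡ n × sum c ≡ 2 * n + 1 × Dominating c

Dnu : List ℕ → ℕ → Set
Dnu c i = 1 < at c i × 1 < at c (suc i)

Do : List ℕ → ℕ → Set
Do c i = at c i ≡ 1 × at c (suc i) ≡ 1

IsAp : List ℕ → ℕ → ℕ → Set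
IsAp c i j =
    (Dnu c i × i < j × j ≤ length c
      × f c (suc i) j ≡ + 0 × at c (suc j) ≡ 1
      × (∀ j′ → i < j′ → j′ < j → ¬ (f c (suc i) j′ ≡ + 0 × at c (suc j′) ≡ 1)))
  ⊎ (Do c i × 1 ≤ j × j < i
      × + 0 ℤ.< f c j (i ∸ 1)
      × (∀ j′ → j < j′ → j′ < i → ¬ (+ 0 ℤ.< f c j′ (i ∸ 1))))

-- z ∈ ⟨x,y⟩  (indices here are positive, so ℕ suffices)
_∈⟨_,_⟩ : ℕ → ℕ → ℕ → Set
z ∈⟨ x , y ⟩ = x ⊓ y ≤ z × z ≤ x ⊔ y

_⊆⟨⟩_ : ℕ × ℕ → ℕ × ℕ → Set
(a Data.Product., b) ⊆⟨⟩ (x Data.Product., y) = ∀ z → z ∈⟨ a , b ⟩ → z ∈⟨ x , y ⟩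

Disjoint⟨⟩ : ℕ × ℕ → ℕ × ℕ → Set
Disjoint⟨⟩ (a Data.Product., b) (x Data.Product., y) = ∀ z → ¬ (z ∈⟨ a , b ⟩ × z ∈⟨ x , y ⟩)

{-# OPTIONS --safe #-}
-- View c as a walk with heights h t = f(c;1,t) and steps c_t − 2 ≥ −1. If
-- c_i ∈ Dnu(c), the walk leaves h i upwards and, since it descends by at most
-- one per step, stays at or above h i up to the first return j = ap(c_i) that is
-- followed by a down-step. If c_i ∈ Do(c) and j = ap(c_i), maximality of j
-- makes h (i−1), which exceeds h (j−1), the minimum of the walk on [j, i−1],
-- and the walk drops right after i−1. Chaining these inequalities through the
-- endpoints of two intervals p < p′ ≤ q < q′ always yields some height strictly
-- below itself, so no two such intervals cross; intervals without crossings
-- are nested or disjoint.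
module Submission where

open import Defs
open import Data.Nat using (ℕ; zero; suc; _+_; _∸_; _≤_; _<_; _⊓_; _⊔_; _<?_; z≤n; s≤s)
import Data.Nat.Properties as ℕ
open import Data.Integer as ℤ using (ℤ; +_; 0ℤ; -1ℤ; +≤+)
import Data.Integer.Properties as ℤ
open import Data.List using (List; []; _∷_; _∷ʳ_; map; applyUpTo; upTo)
open import Data.List.Properties using (map-∘; map-upTo; applyUpTo-∷ʳ)
open import Data.List.Relation.Unary.All using (All; _∷_)
open import Data.Product using (_×_; _,_)
open import Data.Sum using (_⊎_; inj₁; inj₂)
open import Data.Empty using (⊥-elim)
open import Relation.Nullary using (¬_; yes; no)
open import Relation.Binary.Definitions using (tri<; tri≈; tri>)
open import Relation.Binary.PropositionalEquality
  using (_≡_; refl; sym; trans; cong; subst; module ≡-Reasoning)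

step : List ℕ → ℕ → ℤ
step c t = + at c t ℤ.- + 2

height : List ℕ → ℕ → ℤ
height c zero    = 0ℤ
height c (suc t) = height c t ℤ.+ step c (suc t)

sumℤ-∷ʳ : ∀ xs x → sumℤ (xs ∷ʳ x) ≡ sumℤ xs ℤ.+ x
sumℤ-∷ʳ []       x = trans (ℤ.+-identityʳ x) (sym (ℤ.+-identityˡ x))
sumℤ-∷ʳ (y ∷ xs) x = trans (cong (ℤ._+_ y) (sumℤ-∷ʳ xs x)) (sym (ℤ.+-assoc y (sumℤ xs) x))

sum-steps≡height-difference : ∀ c a m →
  sumℤ (applyUpTo (λ t → step c (suc a + t)) m) ≡ height c (a + m) ℤ.- height c a
sum-steps≡height-difference c a zero
  rewrite ℕ.+-identityʳ a = sym (ℤ.+-inverseʳ (height c a))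
sum-steps≡height-difference c a (suc m) = begin
  sumℤ (applyUpTo g (suc m))          ≡⟨ cong sumℤ (sym (applyUpTo-∷ʳ g m)) ⟩
  sumℤ (applyUpTo g m ∷ʳ g m)         ≡⟨ sumℤ-∷ʳ (applyUpTo g m) (g m) ⟩
  sumℤ (applyUpTo g m) ℤ.+ g m        ≡⟨ cong (ℤ._+ g m) (sum-steps≡height-difference c a m) ⟩
  (hₐ₊ₘ ℤ.- hₐ) ℤ.+ g m               ≡⟨ ℤ.+-assoc hₐ₊ₘ (ℤ.- hₐ) (g m) ⟩
  hₐ₊ₘ ℤ.+ (ℤ.- hₐ ℤ.+ g m)           ≡⟨ cong (ℤ._+_ hₐ₊ₘ) (ℤ.+-comm (ℤ.- hₐ) (g m)) ⟩
  hₐ₊ₘ ℤ.+ (g m ℤ.- hₐ)               ≡⟨ sym (ℤ.+-assoc hₐ₊ₘ (g m) (ℤ.- hₐ)) ⟩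
  height c (suc (a + m)) ℤ.- hₐ       ≡⟨ cong (λ s → height c s ℤ.- hₐ) (sym (ℕ.+-suc a m)) ⟩
  height c (a + suc m) ℤ.- hₐ         ∎
  where
  open ≡-Reasoning
  g : ℕ → ℤ
  g t = step c (suc a + t)
  hₐ hₐ₊ₘ : ℤ
  hₐ   = height c a
  hₐ₊ₘ = height c (a + m)

f≡height-difference : ∀ c {a b} → a ≤ b → f c (suc a) b ≡ height c b ℤ.- height c a
f≡height-difference c {a} {b} a≤b = begin
  f c (suc a) b
    ≡⟨ cong sumℤ (sym (map-∘ (upTo (b ∸ a)))) ⟩
  sumℤ (map (λ t → step c (suc a + t)) (upTo (b ∸ a)))
    ≡⟨ cong sumℤ (map-upTo (λ t → step c (suc a + t)) (b ∸ a)) ⟩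
  sumℤ (applyUpTo (λ t → step c (suc a + t)) (b ∸ a))
    ≡⟨ sum-steps≡height-difference c a (b ∸ a) ⟩
  height c (a + (b ∸ a)) ℤ.- height c a
    ≡⟨ cong (λ s → height c s ℤ.- height c a) (ℕ.m+[n∸m]≡n a≤b) ⟩
  height c b ℤ.- height c a ∎
  where open ≡-Reasoning

at-positive : ∀ {c} → All (1 ≤_) c → ∀ t → 1 ≤ at c t
at-positive {[]}    _          _             = s≤s z≤n
at-positive {_ ∷ _} _          zero          = s≤s z≤n
at-positive {_ ∷ _} (1≤x ∷ _)  (suc zero)    = 1≤x
at-positive {_ ∷ _} (_ ∷ 1≤xs) (suc (suc t)) = at-positive 1≤xs (suc t)

pred-height≤height-suc : ∀ {c} → All (1 ≤_) c → ∀ t → ℤ.pred (height c t) ℤ.≤ height c (suc t)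
pred-height≤height-suc {c} 1≤c t = begin
  -1ℤ ℤ.+ height c t            ≤⟨ ℤ.+-monoˡ-≤ (height c t) -1≤step ⟩
  step c (suc t) ℤ.+ height c t ≡⟨ ℤ.+-comm (step c (suc t)) (height c t) ⟩
  height c (suc t)              ∎
  where
  open ℤ.≤-Reasoning
  -1≤step : -1ℤ ℤ.≤ step c (suc t)
  -1≤step = ℤ.+-monoˡ-≤ (ℤ.- + 2) (+≤+ (at-positive 1≤c (suc t)))

height-drops : ∀ c t → at c (suc t) ≡ 1 → height c (suc t) ℤ.< height c t
height-drops c t cₜ₊₁≡1 = begin-strict
  height c t ℤ.+ step c (suc t) ≡⟨ cong (λ x → height c t ℤ.+ (+ x ℤ.- + 2)) cₜ₊₁≡1 ⟩
  height c t ℤ.+ -1ℤ            ≡⟨ ℤ.+-comm (height c t) -1ℤ ⟩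
  ℤ.pred (height c t)           <⟨ ℤ.i≤pred[j]⇒i<j ℤ.≤-refl ⟩
  height c t                    ∎
  where open ℤ.≤-Reasoning

height-rises : ∀ c t → 2 ≤ at c (suc t) → height c t ℤ.≤ height c (suc t)
height-rises c t 2≤cₜ₊₁ = begin
  height c t                    ≡⟨ sym (ℤ.+-identityʳ (height c t)) ⟩
  height c t ℤ.+ 0ℤ             ≤⟨ ℤ.+-monoʳ-≤ (height c t) (ℤ.i≤j⇒0≤j-i (+≤+ 2≤cₜ₊₁)) ⟩
  height c t ℤ.+ step c (suc t) ∎
  where open ℤ.≤-Reasoning

floor-persists : (h : ℕ → ℤ) {m : ℤ} {i j : ℕ} →
  (∀ t → ℤ.pred (h t) ℤ.≤ h (suc t)) →
  (∀ t → i ≤ t → t < j → h t ≡ m → m ℤ.≤ h (suc t)) →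
  m ℤ.≤ h i → ∀ t → i ≤ t → t ≤ j → m ℤ.≤ h t
floor-persists h down leaves m≤hᵢ zero z≤n _ = m≤hᵢ
floor-persists h {m} down leaves m≤hᵢ (suc t) i≤t+1 t<j with ℕ.m≤n⇒m<n∨m≡n i≤t+1
... | inj₂ refl = m≤hᵢ
... | inj₁ (s≤s i≤t) with m ℤ.≟ h t
...   | yes m≡hₜ = leaves t i≤t t<j (sym m≡hₜ)
...   | no m≢hₜ  = ℤ.≤-trans (ℤ.i<j⇒i≤pred[j] (ℤ.≤∧≢⇒< m≤hₜ m≢hₜ)) (down t)
  where
  m≤hₜ : m ℤ.≤ h t
  m≤hₜ = floor-persists h down leaves m≤hᵢ t i≤t (ℕ.<⇒≤ t<j)

-- ⟨i, ap(c_i)⟩ = [p, q]: for Dnu, i = p; for Do, i = q, and the heights that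
-- matter sit at p − 1 and q − 1.
data AnchorInterval (c : List ℕ) : ℕ → ℕ → Set where
  nu : ∀ {p q} → 1 < at c p →
       (∀ t → p ≤ t → t ≤ q → height c p ℤ.≤ height c t) →
       height c q ≡ height c p → at c (suc q) ≡ 1 → AnchorInterval c p q
  o  : ∀ {p q} → height c p ℤ.< height c q →
       (∀ t → suc p ≤ t → t ≤ q → height c q ℤ.≤ height c t) →
       at c (suc q) ≡ 1 → AnchorInterval c (suc p) (suc q)

module _ {c : List ℕ} (1≤c : All (1 ≤_) c) where

  dnu-anchor-interval : ∀ {i j} → Dnu c i → i < j → f c (suc i) j ≡ 0ℤ → at c (suc j) ≡ 1 →
    (∀ j′ → i < j′ → j′ < j → ¬ (f c (suc i) j′ ≡ 0ℤ × at c (suc j′) ≡ 1)) →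
    AnchorInterval c i j
  dnu-anchor-interval {i} {j} (1<cᵢ , 1<cᵢ₊₁) i<j f≡0 cⱼ₊₁≡1 first =
    nu 1<cᵢ (floor-persists (height c) (pred-height≤height-suc 1≤c) leaves ℤ.≤-refl)
       (ℤ.i-j≡0⇒i≡j _ _ (trans (sym (f≡height-difference c (ℕ.<⇒≤ i<j))) f≡0)) cⱼ₊₁≡1
    where
    rises-from-level : ∀ t → i ≤ t → t < j → height c t ≡ height c i → 2 ≤ at c (suc t)
    rises-from-level t i≤t t<j hₜ≡hᵢ with ℕ.m≤n⇒m<n∨m≡n i≤t
    ... | inj₂ refl = 1<cᵢ₊₁
    ... | inj₁ i<t  = ℕ.≤∧≢⇒< (at-positive 1≤c (suc t)) λ 1≡cₜ₊₁ →
      first t i<t t<j (trans (f≡height-difference c i≤t) (ℤ.i≡j⇒i-j≡0 hₜ≡hᵢ) , sym 1≡cₜ₊₁)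

    leaves : ∀ t → i ≤ t → t < j → height c t ≡ height c i → height c i ℤ.≤ height c (suc t)
    leaves t i≤t t<j hₜ≡hᵢ =
      subst (ℤ._≤ height c (suc t)) hₜ≡hᵢ (height-rises c t (rises-from-level t i≤t t<j hₜ≡hᵢ))

  do-anchor-interval : ∀ {i j} → Do c i → 1 ≤ j → j < i → 0ℤ ℤ.< f c j (i ∸ 1) →
    (∀ j′ → j < j′ → j′ < i → ¬ (0ℤ ℤ.< f c j′ (i ∸ 1))) →
    AnchorInterval c j i
  do-anchor-interval {j = zero}    _ () _ _ _
  do-anchor-interval {zero} {suc _} _ _ () _ _
  do-anchor-interval {suc q} {suc p} (cᵢ≡1 , _) _ (s≤s p<q) f>0 last = o hₚ<h_q minimum cᵢ≡1
    where
    hₚ<h_q : height c p ℤ.< height c q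
    hₚ<h_q = ℤ.≰⇒> λ h_q≤hₚ →
      ℤ.<⇒≱ (subst (0ℤ ℤ.<_) (f≡height-difference c (ℕ.<⇒≤ p<q)) f>0) (ℤ.i≤j⇒i-j≤0 h_q≤hₚ)

    minimum : ∀ t → suc p ≤ t → t ≤ q → height c q ℤ.≤ height c t
    minimum t p<t t≤q with ℕ.m≤n⇒m<n∨m≡n t≤q
    ... | inj₂ refl = ℤ.≤-refl
    ... | inj₁ t<q  = ℤ.i-j≤0⇒i≤j (ℤ.≮⇒≥ λ 0<h_q-hₜ →
      last (suc t) (s≤s p<t) (s≤s t<q) (subst (0ℤ ℤ.<_) (sym (f≡height-difference c (ℕ.<⇒≤ t<q))) 0<h_q-hₜ))

  anchor-interval : ∀ {i j} → IsAp c i j → AnchorInterval c (i ⊓ j) (i ⊔ j)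
  anchor-interval (inj₁ (dnuᵢ , i<j , _ , f≡0 , cⱼ₊₁≡1 , first))
    rewrite ℕ.m≤n⇒m⊓n≡m (ℕ.<⇒≤ i<j) | ℕ.m≤n⇒m⊔n≡n (ℕ.<⇒≤ i<j) =
    dnu-anchor-interval dnuᵢ i<j f≡0 cⱼ₊₁≡1 first
  anchor-interval (inj₂ (doᵢ , 1≤j , j<i , f>0 , last))
    rewrite ℕ.m≥n⇒m⊓n≡n (ℕ.<⇒≤ j<i) | ℕ.m≥n⇒m⊔n≡m (ℕ.<⇒≤ j<i) =
    do-anchor-interval doᵢ 1≤j j<i f>0 last

Crosses : ℕ → ℕ → ℕ → ℕ → Set
Crosses p q p′ q′ = p < p′ × p′ ≤ q × q < q′

anchor-intervals-do-not-cross : ∀ {c p q p′ q′} →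
  AnchorInterval c p q → AnchorInterval c p′ q′ → ¬ Crosses p q p′ q′
anchor-intervals-do-not-cross {c} {p} {q} {p′} {q′}
  (nu _ min₁ level₁ drop₁) (nu _ min₂ _ _) (p<p′ , p′≤q , q<q′) =
  ℤ.<-irrefl refl (begin-strict
    height c p         ≤⟨ min₁ p′ (ℕ.<⇒≤ p<p′) p′≤q ⟩
    height c p′        ≤⟨ min₂ (suc q) (ℕ.m≤n⇒m≤1+n p′≤q) q<q′ ⟩
    height c (suc q)   <⟨ height-drops c q drop₁ ⟩
    height c q         ≡⟨ level₁ ⟩
    height c p         ∎)
  where open ℤ.≤-Reasoning
anchor-intervals-do-not-cross {c} {p} {q} {suc p′} {suc q′}
  (nu _ min₁ level₁ _) (o rise₂ min₂ _) (p<p′ , p′≤q , q<q′) =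
  ℤ.<-irrefl refl (begin-strict
    height c p         ≤⟨ min₁ p′ (ℕ.≤-pred p<p′) (ℕ.<⇒≤ p′≤q) ⟩
    height c p′        <⟨ rise₂ ⟩
    height c q′        ≤⟨ min₂ q p′≤q (ℕ.≤-pred q<q′) ⟩
    height c q         ≡⟨ level₁ ⟩
    height c p         ∎)
  where open ℤ.≤-Reasoning
anchor-intervals-do-not-cross {c} {suc p} {suc q} {p′} {q′}
  (o _ min₁ end₁) (nu start₂ min₂ _ _) (p<p′ , p′≤q+1 , q<q′) =
  ℤ.<-irrefl refl (begin-strict
    height c q         ≤⟨ min₁ p′ (ℕ.<⇒≤ p<p′) p′≤q ⟩
    height c p′        ≤⟨ min₂ (suc q) p′≤q+1 (ℕ.<⇒≤ q<q′) ⟩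
    height c (suc q)   <⟨ height-drops c q end₁ ⟩
    height c q         ∎)
  where
  open ℤ.≤-Reasoning
  -- c_{q+1} = 1 < c_{p′} rules out p′ = q + 1.
  p′≤q : p′ ≤ q
  p′≤q with ℕ.m≤n⇒m<n∨m≡n p′≤q+1
  ... | inj₁ p′<q+1 = ℕ.≤-pred p′<q+1
  ... | inj₂ refl   = ⊥-elim (ℕ.<-irrefl (sym end₁) start₂)
anchor-intervals-do-not-cross {c} {suc p} {suc q} {suc p′} {suc q′}
  (o _ min₁ end₁) (o rise₂ min₂ _) (p<p′ , p′≤q , q<q′) =
  ℤ.<-irrefl refl (begin-strict
    height c q         ≤⟨ min₁ p′ (ℕ.≤-pred p<p′) (ℕ.≤-pred p′≤q) ⟩
    height c p′        <⟨ rise₂ ⟩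
    height c q′        ≤⟨ min₂ (suc q) p′≤q (ℕ.≤-pred q<q′) ⟩
    height c (suc q)   <⟨ height-drops c q end₁ ⟩
    height c q         ∎)
  where open ℤ.≤-Reasoning

_∈[_,_] : ℕ → ℕ → ℕ → Set
z ∈[ a , b ] = a ≤ z × z ≤ b

[_,_]⊆[_,_] : ℕ → ℕ → ℕ → ℕ → Set
[ a , b ]⊆[ x , y ] = ∀ z → z ∈[ a , b ] → z ∈[ x , y ]

NestedOrDisjoint : ℕ → ℕ → ℕ → ℕ → Set
NestedOrDisjoint a b x y =
  [ a , b ]⊆[ x , y ] ⊎ [ x , y ]⊆[ a , b ] ⊎ (∀ z → ¬ (z ∈[ a , b ] × z ∈[ x , y ]))

⊆-from-endpoints : ∀ {a b x y} → x ≤ a → b ≤ y → [ a , b ]⊆[ x , y ]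
⊆-from-endpoints x≤a b≤y _ (a≤z , z≤b) = ℕ.≤-trans x≤a a≤z , ℕ.≤-trans z≤b b≤y

non-crossing⇒nested-or-disjoint : ∀ {a b x y} →
  ¬ Crosses a b x y → ¬ Crosses x y a b → NestedOrDisjoint a b x y
non-crossing⇒nested-or-disjoint {a} {b} {x} {y} ¬ab ¬xy with b <? x | y <? a
... | yes b<x | _ = inj₂ (inj₂ λ _ ((_ , z≤b) , (x≤z , _)) → ℕ.<⇒≱ (ℕ.≤-<-trans z≤b b<x) x≤z)
... | no _ | yes y<a = inj₂ (inj₂ λ _ ((a≤z , _) , (_ , z≤y)) → ℕ.<⇒≱ (ℕ.≤-<-trans z≤y y<a) a≤z)
... | no b≮x | no y≮a with ℕ.<-cmp a x
...   | tri< a<x _ _ = inj₂ (inj₁ (⊆-from-endpoints (ℕ.<⇒≤ a<x)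
                         (ℕ.≮⇒≥ λ b<y → ¬ab (a<x , ℕ.≮⇒≥ b≮x , b<y))))
...   | tri> _ _ x<a = inj₁ (⊆-from-endpoints (ℕ.<⇒≤ x<a)
                         (ℕ.≮⇒≥ λ y<b → ¬xy (x<a , ℕ.≮⇒≥ y≮a , y<b)))
...   | tri≈ _ refl _ with ℕ.≤-total b y
...     | inj₁ b≤y = inj₁ (⊆-from-endpoints ℕ.≤-refl b≤y)
...     | inj₂ y≤b = inj₂ (inj₁ (⊆-from-endpoints ℕ.≤-refl y≤b))

lemma4p7 : (n : ℕ) → 1 ≤ n → (c : List ℕ) → DComp n c →
    (i k j l : ℕ) → 1 ≤ i → i ≤ n → 1 ≤ k → k ≤ n → ¬ (i ≡ k) →
    (Dnu c i ⊎ Do c i) → (Dnu c k ⊎ Do c k) →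
    IsAp c i j → IsAp c k l →
    ((i , j) ⊆⟨⟩ (k , l)) ⊎ ((k , l) ⊆⟨⟩ (i , j)) ⊎ Disjoint⟨⟩ (i , j) (k , l)
lemma4p7 _ _ c (1≤c , _) i k j l _ _ _ _ _ _ _ apᵢ apₖ =
  non-crossing⇒nested-or-disjoint
    (anchor-intervals-do-not-cross Iᵢ Iₖ) (anchor-intervals-do-not-cross Iₖ Iᵢ)
  where
  Iᵢ : AnchorInterval c (i ⊓ j) (i ⊔ j)
  Iᵢ = anchor-interval 1≤c apᵢ
  Iₖ : AnchorInterval c (k ⊓ l) (k ⊔ l)
  Iₖ = anchor-interval 1≤c apₖ
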